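{- Let $(\mathcal G,s,z,\delta,k)$ be an instance of \textsc{Short Restless Temporal Path} with $d(s,1)\le k$ and let $\ell:=k-d(s,1)$, so $k=d(s,1)+\ell$. Let $P=((\{v_{i-1},v_i\},t_i))_{i=1}^k$ be a $\delta$-restless temporal $s$-$z$ path in $\mathcal G$ (so $v_0=s$, $v_k=z$), and set $t_0:=1$, $t_{k+1}:=t_k$. Then for every $i\in[0,k]$ there is a $j\in[0,2\ell]$ (with $i+j\le k$) such that $v_{i+j}$ is a distance separator.
   Context: A temporal graph is $\mathcal G=(V,(E_i)_{i=1}^{\tau})$ with each $E_i$ a set of 2-element subsets of $V$; time-edges are elements of $\bigcup_i E_i\times\{i\}$. A temporal $x$-$y$ path of length $m$ is a sequence $((\{v_{i-1},v_i\},t_i))_{i=1}^m$ of time-edges with $v_0=x$, $v_m=y$, $v_0,\dots,v_m$ pairwise distinct and $t_i\le t_{i+1}$; its departure time is $t_1$; it is $\delta$-restless if moreover $t_{i+1}\le t_i+\delta$ for all $i$. \textsc{Short Restless Temporal Path}: given $\mathcal G$, distinct $s,z$, $\delta,k\in\mathbb N$, is there a $\delta$-restless temporal $s$-$z$ path of length at most $k$? $d(v,t)$ denotes the minimum length of a temporal $v$-$z$ path in $\mathcal G$ with departure time at least $t$ ($\infty$ if none; $d(z,t)=0$). For the path $P$ (with $t_0=1$, $t_{k+1}=t_k$), vertex $v_i$, $i\in[0,k]$, is a distance separator if (i) $d(v_i,t_{i+1})<d(v_j,t_{j+1})$ for all $j\in[0,i-1]$ and (ii) $d(v_i,t_{i+1})>d(v_j,t_{j+1})$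 for all $j\in[i+1,k]$. $[a,b]=\{i\in\mathbb Z: a\le i\le b\}$. -}

module Defs where

open import Data.Nat using (ℕ; zero; suc; _+_; _∸_; _≤_; _<_; _≤ᵇ_; _≡ᵇ_)
open import Data.Fin using (Fin)
open import Data.Bool using (Bool; true; false; if_then_else_)
open import Data.Product using (Σ; _×_; _,_)
open import Data.Sum using (_⊎_)
open import Data.Empty using (⊥)
open import Data.Unit using (⊤)
open import Relation.Nullary using (¬_)
open import Relation.Binary.PropositionalEquality using (_≡_)

-- The edge set E_t (1 ≤ t ≤ τ) is given by a Boolean function;
-- {u,v} ∈ E_t iff  E t u v ≡ true  or  E t v u ≡ true  (an arbitrary set of
-- 2-element subsets is representable this way; loops are never usable in paths
-- since path vertices are pairwise distinct).
record TemporalGraph : Set where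
  field
    n : ℕ
    τ : ℕ
    E : ℕ → Fin n → Fin n → Bool

open TemporalGraph public

TimeEdge : (G : TemporalGraph) → ℕ → Fin (n G) → Fin (n G) → Set
TimeEdge G t u v = (1 ≤ t) × (t ≤ τ G) × ((E G t u v ≡ true) ⊎ (E G t v u ≡ true))

-- A temporal x-y path of length m: vertices v_0..v_m (vert), times t_1..t_m (time).
record TPath (G : TemporalGraph) (x y : Fin (n G)) (m : ℕ) : Set where
  field
    vert     : ℕ → Fin (n G)
    time     : ℕ → ℕ
    start    : vert 0 ≡ x
    end      : vert m ≡ y
    distinct : ∀ a b → a ≤ m → b ≤ m → vert a ≡ vert b → a ≡ b
    edges    : ∀ i → i < m → TimeEdge G (time (suc i)) (vert i) (vert (suc i))
    mono     : ∀ i → 1 ≤ i → i < m → time i ≤ time (suc i)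

open TPath public

Restless : ∀ {G x y m} → ℕ → TPath G x y m → Set
Restless {m = m} δ P = ∀ i → 1 ≤ i → i < m → time P (suc i) ≤ time P i + δ

-- a temporal v-z path of length m with departure time at least t
-- (for m = 0 there is no departure time; the path is then the trivial one, v = z)
Reach : (G : TemporalGraph) (z v : Fin (n G)) (t m : ℕ) → Set
Reach G z v t m = Σ (TPath G v z m) λ P → (1 ≤ m → t ≤ time P 1)

data ℕ∞ : Set where
  fin : ℕ → ℕ∞
  ∞   : ℕ∞

_<∞_ : ℕ∞ → ℕ∞ → Set
fin a <∞ fin b = a < b
fin a <∞ ∞     = ⊤
∞     <∞ _     = ⊥

IsDist : (G : TemporalGraph) (z v : Fin (n G)) (t : ℕ) → ℕ∞ → Set
IsDist G z v t (fin m) = Reach G z v t m × (∀ m' → Reach G z v t m' → m ≤ m')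
IsDist G z v t ∞       = ∀ m → ¬ Reach G z v t m

ext-time : ∀ {G x y k} → TPath G x y k → ℕ → ℕ
ext-time P zero = 1
ext-time {k = k} P (suc i) = if suc i ≤ᵇ k then time P (suc i) else time P k

DistSep : (G : TemporalGraph) (d : Fin (n G) → ℕ → ℕ∞) {x y : Fin (n G)} {k : ℕ}
          (P : TPath G x y k) (i : ℕ) → Set
DistSep G d {k = k} P i =
  (∀ j → j < i → D i <∞ D j) × (∀ j → i < j → j ≤ k → D j <∞ D i)
  where
  D : ℕ → ℕ∞
  D j = d (vert P j) (ext-time P (suc j))

{-# OPTIONS --safe #-}
module Submission where

-- Along P put D j := d(v_j, t_{j+1}). Prepending the time-edge ({v_j, v_{j+1}}, t_{j+1}) to a
-- shortest path from v_{j+1} (or cutting that path at v_j, if it passes there) shows that D drops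
-- by at most one per step; D is positive before k and D k = 0. Hence the slack D j + j is
-- nondecreasing, from D 0 ≥ d(s,1) up to k. From the first position q ≤ i with D q ≤ D i, a strict
-- prefix minimum, we descend level by level to a distance separator p ≥ i. Every time the profile
-- climbs back above the current level before descending further, slack is spent, and the
-- bookkeeping shows that the potential 2 D j + j does not decrease from q to p, i.e.
-- p − q ≤ 2 (slack p − slack q) ≤ 2 (k − d(s,1)).

open import Defs
open import Data.Nat using (ℕ; zero; suc; _+_; _∸_; _*_; _≤_; _<_; z≤n; s≤s; s≤s⁻¹; _≤?_; _<?_; _<ᵇ_)
open import Data.Nat.Properties
open import Data.Nat.Induction using (<-rec)
open import Data.Nat.Tactic.RingSolver using (solve-∀)
open import Data.Fin using (Fin)
open import Data.Fin.Properties using () renaming (_≟_ to _≟ᶠ_)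
open import Data.Bool using (true; false)
open import Data.Product using (Σ; ∃; _×_; _,_; proj₁; proj₂)
open import Data.Sum using (_⊎_; inj₁; inj₂)
open import Relation.Nullary using (¬_; Dec; yes; no; contradiction)
open import Relation.Nullary.Decidable using (_×-dec_; map′)
open import Relation.Unary using (Decidable)
open import Relation.Binary.PropositionalEquality

module _ {P : ℕ → Set} (P? : Decidable P) where

  Least : ℕ → Set
  Least n = ∃ λ m → m ≤ n × P m × (∀ j → j < m → ¬ P j)

  least : ∀ n → P n → Least n
  least = <-rec (λ n → P n → Least n) search
    where
    search : ∀ n → (∀ {j} → j < n → P j → Least j) → P n → Least n
    search n rec Pn with anyUpTo? P? n
    ... | no none = n , ≤-refl , Pn , λ j j<n Pj → none (j , j<n , Pj)
    ... | yes (j , j<n , Pj) with rec j<n Pj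
    ...   | m , m≤j , Pm , below = m , ≤-trans m≤j (<⇒≤ j<n) , Pm , below

m+n≤o+i⇒m∸i≤o∸n : ∀ {m n o i} → i ≤ m → m + n ≤ o + i → m ∸ i ≤ o ∸ n
m+n≤o+i⇒m∸i≤o∸n {m} {n} {o} {i} i≤m le = m+n≤o⇒m≤o∸n (m ∸ i) (+-cancelʳ-≤ i _ _ (begin
  m ∸ i + n + i  ≡⟨ swap (m ∸ i) n i ⟩
  m ∸ i + i + n  ≡⟨ cong (_+ n) (m∸n+n≡m i≤m) ⟩
  m + n          ≤⟨ le ⟩
  o + i          ∎))
  where
  open ≤-Reasoning
  swap : ∀ a n i → a + n + i ≡ a + i + n
  swap = solve-∀

module Profile (k : ℕ) (D : ℕ → ℕ)
  (D-step : ∀ {j} → j < k → D j ≤ suc (D (suc j)))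
  (D-last : D k ≡ 0)
  (D-pos : ∀ {j} → j < k → 0 < D j) where

  LeftSep : ℕ → Set
  LeftSep q = ∀ j → j < q → D q < D j

  RightSep : ℕ → Set
  RightSep q = ∀ j → q < j → j ≤ k → D j < D q

  Separator : ℕ → Set
  Separator q = LeftSep q × RightSep q

  leftSep-min : ∀ {q j} → LeftSep q → j ≤ q → D q ≤ D j
  leftSep-min {q} {j} left j≤q with m≤n⇒m<n∨m≡n j≤q
  ... | inj₁ j<q = <⇒≤ (left j j<q)
  ... | inj₂ refl = ≤-refl

  slack : ℕ → ℕ
  slack j = D j + j

  slack-mono : ∀ {a b} → a ≤ b → b ≤ k → slack a ≤ slack b
  slack-mono {a} {zero} a≤0 _ = ≤-reflexive (cong slack (n≤0⇒n≡0 a≤0))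
  slack-mono {a} {suc b} a≤1+b 1+b≤k with m≤n⇒m<n∨m≡n a≤1+b
  ... | inj₂ refl = ≤-refl
  ... | inj₁ (s≤s a≤b) = ≤-trans (slack-mono a≤b (<⇒≤ 1+b≤k)) (begin
    D b + b              ≤⟨ +-monoˡ-≤ b (D-step 1+b≤k) ⟩
    suc (D (suc b)) + b  ≡⟨ sym (+-suc (D (suc b)) b) ⟩
    D (suc b) + suc b    ∎)
    where open ≤-Reasoning

  slack-≤ : ∀ {p} → p ≤ k → slack p ≤ k
  slack-≤ p≤k = ≤-trans (slack-mono p≤k ≤-refl) (≤-reflexive (cong (_+ k) D-last))

  FirstAtMost : ℕ → ℕ → Set
  FirstAtMost c m = D m ≤ c × (∀ j → j < m → c < D j)

  firstAtMost : ∀ c {w} → D w ≤ c → ∃ λ m → m ≤ w × FirstAtMost c m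
  firstAtMost c {w} Dw≤c with least (λ j → D j ≤? c) w Dw≤c
  ... | m , m≤w , Dm≤c , below = m , m≤w , Dm≤c , λ j j<m → ≰⇒> (below j j<m)

  firstAtMost-leftSep : ∀ {c m} → FirstAtMost c m → LeftSep m
  firstAtMost-leftSep (Dm≤c , below) j j<m = ≤-<-trans Dm≤c (below j j<m)

  firstAtMost-exact : ∀ {c m} → FirstAtMost c m → 0 < m → m ≤ k → D m ≡ c
  firstAtMost-exact {m = suc m} (Dm≤c , below) _ m<k =
    ≤-antisym Dm≤c (s≤s⁻¹ (≤-trans (below _ ≤-refl) (D-step m<k)))

  RisesAfter : ℕ → ℕ → Set
  RisesAfter φ q = ∃ λ j → q < j × j ≤ k × φ + D q ≤ D j

  risesAfter? : ∀ φ q → Dec (RisesAfter φ q)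
  risesAfter? φ q = map′
    (λ (j , j<1+k , q<j , rise) → j , q<j , s≤s⁻¹ j<1+k , rise)
    (λ (j , q<j , j≤k , rise) → j , s≤s j≤k , q<j , rise)
    (anyUpTo? (λ j → q <? j ×-dec φ + D q ≤? D j) (suc k))

  ¬risesAfter⇒rightSep : ∀ {q} → ¬ RisesAfter 0 q → RightSep q
  ¬risesAfter⇒rightSep flat j q<j j≤k = ≰⇒> λ Dq≤Dj → flat (j , q<j , j≤k , Dq≤Dj)

  rightSep⇒¬risesAfter : ∀ {φ q} → RightSep q → ¬ RisesAfter φ q
  rightSep⇒¬risesAfter {φ} right (j , q<j , j≤k , rise) =
    <⇒≱ (right j q<j j≤k) (m+n≤o⇒n≤o φ rise)

  potential : ℕ → ℕ
  potential j = 2 * D j + j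

  potential-descent : ∀ φ {q m} → D q ≡ suc (D m) → q < m → φ + potential q ≤ suc φ + potential m
  potential-descent φ {q} {m} Dq≡ q<m = begin
    φ + (2 * D q + q)          ≡⟨ cong (λ x → φ + (2 * x + q)) Dq≡ ⟩
    φ + (2 * suc (D m) + q)    ≡⟨ shuffle φ (D m) q ⟩
    suc φ + (2 * D m + suc q)  ≤⟨ +-monoʳ-≤ (suc φ) (+-monoʳ-≤ (2 * D m) q<m) ⟩
    suc φ + (2 * D m + m)      ∎
    where
    open ≤-Reasoning
    shuffle : ∀ φ a q → φ + (2 * suc a + q) ≡ suc φ + (2 * a + suc q)
    shuffle = solve-∀

  potential-jump : ∀ φ {q j m} → D q ≡ suc (D m) → q < j → φ + D q + j ≤ slack m
                 → φ + potential q ≤ potential m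
  potential-jump φ {q} {j} {m} Dq≡ q<j climb = begin
    φ + (2 * D q + q)            ≡⟨ cong (λ x → φ + (2 * x + q)) Dq≡ ⟩
    φ + (2 * suc (D m) + q)      ≡⟨ shuffle φ (D m) q ⟩
    φ + suc (D m) + suc q + D m  ≤⟨ +-monoˡ-≤ (D m) (+-monoʳ-≤ (φ + suc (D m)) q<j) ⟩
    φ + suc (D m) + j + D m      ≡⟨ cong (λ x → φ + x + j + D m) (sym Dq≡) ⟩
    φ + D q + j + D m            ≤⟨ +-monoˡ-≤ (D m) climb ⟩
    D m + m + D m                ≡⟨ regroup (D m) m ⟩
    2 * D m + m                  ∎
    where
    open ≤-Reasoning
    shuffle : ∀ φ a q → φ + (2 * suc a + q) ≡ φ + suc a + suc q + a
    shuffle = solve-∀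
    regroup : ∀ a m → a + m + a ≡ 2 * a + m
    regroup = solve-∀

  nextLevel : ∀ {q v} → LeftSep q → D q ≡ suc v → ∃ λ m → q < m × m ≤ k × LeftSep m × D m ≡ v
  nextLevel {q} {v} left Dq≡ with firstAtMost v (≤-trans (≤-reflexive D-last) z≤n)
  ... | m , m≤k , first =
    m , q<m , m≤k , firstAtMost-leftSep first , firstAtMost-exact first (≤-<-trans z≤n q<m) m≤k
    where
    q<m : q < m
    q<m = ≰⇒> λ m≤q → <⇒≱ (n<1+n v)
      (subst (_≤ v) Dq≡ (≤-trans (leftSep-min left m≤q) (proj₁ first)))

  rise-before : ∀ {φ q m} → D q ≡ suc (D m) → m ≤ k → RisesAfter φ q → ¬ RisesAfter (suc φ) m
              → φ + potential q ≤ potential m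
  rise-before {φ} {q} {m} Dq≡ m≤k (j , q<j , j≤k , rise) flat = potential-jump φ Dq≡ q<j climb
    where
    rise′ : suc φ + D m ≤ D j
    rise′ = subst (_≤ D j) (trans (cong (φ +_) Dq≡) (+-suc φ (D m))) rise
    j<m : j < m
    j<m = ≤∧≢⇒< (≮⇒≥ λ m<j → flat (j , m<j , j≤k , rise′))
                 λ { refl → <⇒≱ rise′ (m≤n+m (D m) φ) }
    climb : φ + D q + j ≤ slack m
    climb = ≤-trans (+-monoˡ-≤ j rise) (slack-mono (<⇒≤ j<m) m≤k)

  -- The debt φ records a position after q lying φ levels above q.
  -- Descending to the next level m, that position either lies beyond m, and the debt grows by one,
  -- or before m, and the slack spent up to m pays it off (rise-before).
  separator-from : ∀ v {q} φ → D q ≡ v → q ≤ k → LeftSep q → φ ≡ 0 ⊎ RisesAfter φ q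
                 → ∃ λ p → q ≤ p × p ≤ k × Separator p × φ + potential q ≤ potential p
  separator-from v {q} φ Dq≡v q≤k left debt with risesAfter? 0 q
  ... | no flat = q , ≤-refl , q≤k , (left , right) , settled debt
    where
    right : RightSep q
    right = ¬risesAfter⇒rightSep flat
    settled : φ ≡ 0 ⊎ RisesAfter φ q → φ + potential q ≤ potential q
    settled (inj₁ refl) = ≤-refl
    settled (inj₂ rise) = contradiction rise (rightSep⇒¬risesAfter right)
  ... | yes rise₀@(j₀ , q<j₀ , j₀≤k , _) = descend v Dq≡v
    where
    rise : φ ≡ 0 ⊎ RisesAfter φ q → RisesAfter φ q
    rise (inj₁ refl) = rise₀
    rise (inj₂ r) = r
    descend : ∀ v → D q ≡ v → ∃ λ p → q ≤ p × p ≤ k × Separator p × φ + potential q ≤ potential p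
    descend zero Dq≡0 = contradiction Dq≡0 (n>0⇒n≢0 (D-pos (<-≤-trans q<j₀ j₀≤k)))
    descend (suc v) Dq≡1+v with nextLevel left Dq≡1+v
    ... | m , q<m , m≤k , left-m , Dm≡v with risesAfter? (suc φ) m
    ...   | yes riseₘ with separator-from v (suc φ) Dm≡v m≤k left-m (inj₂ riseₘ)
    ...     | p , m≤p , p≤k , sep , m⇝p =
      p , ≤-trans (<⇒≤ q<m) m≤p , p≤k , sep , ≤-trans (potential-descent φ Dq≡ q<m) m⇝p
      where
      Dq≡ : D q ≡ suc (D m)
      Dq≡ = trans Dq≡1+v (cong suc (sym Dm≡v))
    descend (suc v) Dq≡1+v | m , q<m , m≤k , left-m , Dm≡v | no flatₘ
      with separator-from v 0 Dm≡v m≤k left-m (inj₁ refl)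
    ... | p , m≤p , p≤k , sep , m⇝p =
      p , ≤-trans (<⇒≤ q<m) m≤p , p≤k , sep , ≤-trans (rise-before Dq≡ m≤k (rise debt) flatₘ) m⇝p
      where
      Dq≡ : D q ≡ suc (D m)
      Dq≡ = trans Dq≡1+v (cong suc (sym Dm≡v))

  separator-within : ∀ {i} → i ≤ k → ∃ λ p → i ≤ p × p ≤ k × Separator p × p ∸ i ≤ 2 * (k ∸ D 0)
  separator-within {i} i≤k with firstAtMost (D i) ≤-refl
  ... | q , q≤i , first with separator-from (D q) 0 refl (≤-trans q≤i i≤k) (firstAtMost-leftSep first) (inj₁ refl)
  ...   | p , q≤p , p≤k , sep@(left , right) , q⇝p =
    p , i≤p , p≤k , sep , ≤-trans (m+n≤o+i⇒m∸i≤o∸n i≤p bound) (≤-reflexive (sym (*-distribˡ-∸ 2 k (D 0))))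
    where
    q≤k : q ≤ k
    q≤k = ≤-trans q≤i i≤k
    i≤p : i ≤ p
    i≤p = ≮⇒≥ λ p<i → <⇒≱ (right i p<i i≤k) (≤-trans (leftSep-min left q≤p) (proj₁ first))
    bound : p + 2 * D 0 ≤ 2 * k + i
    bound = begin
      p + 2 * D 0              ≡⟨ cong (λ x → p + 2 * x) (sym (+-identityʳ (D 0))) ⟩
      p + 2 * slack 0          ≤⟨ +-monoʳ-≤ p (*-monoʳ-≤ 2 (slack-mono z≤n q≤k)) ⟩
      p + 2 * slack q          ≡⟨ shuffle p (D q) q ⟩
      potential q + (p + q)    ≤⟨ +-monoˡ-≤ (p + q) q⇝p ⟩
      potential p + (p + q)    ≡⟨ regroup (D p) p q ⟩
      2 * slack p + q          ≤⟨ +-monoˡ-≤ q (*-monoʳ-≤ 2 (slack-≤ p≤k)) ⟩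
      2 * k + q                ≤⟨ +-monoʳ-≤ (2 * k) q≤i ⟩
      2 * k + i                ∎
      where
      open ≤-Reasoning
      shuffle : ∀ p a q → p + 2 * (a + q) ≡ (2 * a + q) + (p + q)
      shuffle = solve-∀
      regroup : ∀ a p q → (2 * a + p) + (p + q) ≡ 2 * (a + p) + q
      regroup = solve-∀

module _ {G : TemporalGraph} {x y : Fin (n G)} {m : ℕ} (Q : TPath G x y m) where

  time-mono : ∀ {a b} → 1 ≤ a → a ≤ b → b ≤ m → time Q a ≤ time Q b
  time-mono {a} {zero} 1≤a a≤0 _ = contradiction (≤-trans 1≤a a≤0) λ ()
  time-mono {a} {suc b} 1≤a a≤1+b 1+b≤m with m≤n⇒m<n∨m≡n a≤1+b
  ... | inj₂ refl = ≤-refl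
  ... | inj₁ (s≤s a≤b) = ≤-trans (time-mono 1≤a a≤b (<⇒≤ 1+b≤m)) (mono Q b (≤-trans 1≤a a≤b) 1+b≤m)

  departs-after-1 : 1 ≤ m → 1 ≤ time Q 1
  departs-after-1 1≤m = proj₁ (edges Q 0 1≤m)

  suffix : ∀ a → a ≤ m → TPath G (vert Q a) y (m ∸ a)
  suffix a a≤m = record
    { vert = λ i → vert Q (a + i)
    ; time = λ i → time Q (a + i)
    ; start = cong (vert Q) (+-identityʳ a)
    ; end = trans (cong (vert Q) (m+[n∸m]≡n a≤m)) (end Q)
    ; distinct = λ i j i≤ j≤ e → +-cancelˡ-≡ a i j (distinct Q (a + i) (a + j) (shift i≤) (shift j≤) e)
    ; edges = λ i i< → subst (λ w → TimeEdge G (time Q w) (vert Q (a + i)) (vert Q w)) (sym (+-suc a i))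
                         (edges Q (a + i) (shift< i<))
    ; mono = λ i 1≤i i< → subst (λ w → time Q (a + i) ≤ time Q w) (sym (+-suc a i))
                         (mono Q (a + i) (≤-trans 1≤i (m≤n+m i a)) (shift< i<))
    }
    where
    shift : ∀ {i} → i ≤ m ∸ a → a + i ≤ m
    shift {i} i≤ = subst (a + i ≤_) (m+[n∸m]≡n a≤m) (+-monoʳ-≤ a i≤)
    shift< : ∀ {i} → i < m ∸ a → a + i < m
    shift< {i} i< = subst (a + i <_) (m+[n∸m]≡n a≤m) (+-monoʳ-< a i<)

  prepend : ∀ {t u} → TimeEdge G t u x → (∀ a → a ≤ m → vert Q a ≢ u) → (1 ≤ m → t ≤ time Q 1) → TPath G u y (suc m)
  prepend {t} {u} e fresh departs = record
    { vert = vert′ ; time = time′ ; start = refl ; end = end Q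
    ; distinct = distinct′ ; edges = edges′ ; mono = mono′ }
    where
    vert′ : ℕ → Fin (n G)
    vert′ zero = u
    vert′ (suc a) = vert Q a
    time′ : ℕ → ℕ
    time′ (suc (suc a)) = time Q (suc a)
    time′ _ = t
    distinct′ : ∀ a b → a ≤ suc m → b ≤ suc m → vert′ a ≡ vert′ b → a ≡ b
    distinct′ zero zero _ _ _ = refl
    distinct′ zero (suc b) _ b≤ eq = contradiction (sym eq) (fresh b (s≤s⁻¹ b≤))
    distinct′ (suc a) zero a≤ _ eq = contradiction eq (fresh a (s≤s⁻¹ a≤))
    distinct′ (suc a) (suc b) a≤ b≤ eq = cong suc (distinct Q a b (s≤s⁻¹ a≤) (s≤s⁻¹ b≤) eq)
    edges′ : ∀ i → i < suc m → TimeEdge G (time′ (suc i)) (vert′ i) (vert′ (suc i))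
    edges′ zero _ = subst (TimeEdge G t u) (sym (start Q)) e
    edges′ (suc i) i< = edges Q i (s≤s⁻¹ i<)
    mono′ : ∀ i → 1 ≤ i → i < suc m → time′ i ≤ time′ (suc i)
    mono′ (suc zero) _ i< = departs (s≤s⁻¹ i<)
    mono′ (suc (suc i)) _ i< = mono Q (suc i) (s≤s z≤n) (s≤s⁻¹ i<)

zero-length⇒start≡end : ∀ {G x y} → TPath G x y 0 → x ≡ y
zero-length⇒start≡end Q = trans (sym (start Q)) (end Q)

-- The junk value ∞ ↦ 0 is never read: toℕ is only applied to distances witnessed by a path.
toℕ : ℕ∞ → ℕ
toℕ (fin m) = m
toℕ ∞ = 0

reachable-isDist : ∀ {G z v t e m} → IsDist G z v t e → Reach G z v t m → IsDist G z v t (fin (toℕ e))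
reachable-isDist {e = fin _} isDist _ = isDist
reachable-isDist {e = ∞} unreachable r = contradiction r (unreachable _)

reachable-finite : ∀ {G z v t e m} → IsDist G z v t e → Reach G z v t m → e ≡ fin (toℕ e)
reachable-finite {e = fin _} _ _ = refl
reachable-finite {e = ∞} unreachable r = contradiction r (unreachable _)

module PathProfile {G : TemporalGraph} {z : Fin (n G)} (d : Fin (n G) → ℕ → ℕ∞)
  (d-isDist : ∀ v t → IsDist G z v t (d v t)) {s : Fin (n G)} {k : ℕ} (P : TPath G s z k) where

  depart : ℕ → ℕ
  depart j = ext-time P (suc j)

  depart-inner : ∀ {j} → j < k → depart j ≡ time P (suc j)
  depart-inner {j} j<k with j <ᵇ k | <⇒<ᵇ j<k
  ... | true | _ = refl

  depart-last : depart k ≡ time P k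
  depart-last with k <ᵇ k | <ᵇ⇒< k k
  ... | false | _ = refl
  ... | true | k<k = contradiction (k<k _) (<-irrefl refl)

  time≤depart : ∀ {j} → j < k → time P (suc j) ≤ depart (suc j)
  time≤depart {j} j<k with m≤n⇒m<n∨m≡n j<k
  ... | inj₁ 1+j<k = ≤-trans (mono P (suc j) (s≤s z≤n) 1+j<k) (≤-reflexive (sym (depart-inner 1+j<k)))
  ... | inj₂ refl = ≤-reflexive (sym depart-last)

  reach-suffix : ∀ {j} → j ≤ k → Reach G z (vert P j) (depart j) (k ∸ j)
  reach-suffix {j} j≤k = suffix P j j≤k , λ 0<k∸j →
    ≤-reflexive (trans (depart-inner (m∸n≢0⇒n<m {k} {j} λ e → <-irrefl (sym e) 0<k∸j))
                       (cong (time P) (+-comm 1 j)))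

  D : ℕ → ℕ
  D j = toℕ (d (vert P j) (depart j))

  D-isDist : ∀ {j} → j ≤ k → IsDist G z (vert P j) (depart j) (fin (D j))
  D-isDist j≤k = reachable-isDist (d-isDist _ _) (reach-suffix j≤k)

  D-finite : ∀ {j} → j ≤ k → d (vert P j) (depart j) ≡ fin (D j)
  D-finite j≤k = reachable-finite (d-isDist _ _) (reach-suffix j≤k)

  D-last : D k ≡ 0
  D-last = n≤0⇒n≡0 (≤-trans (proj₂ (D-isDist ≤-refl) _ (reach-suffix ≤-refl)) (≤-reflexive (n∸n≡0 k)))

  D-pos : ∀ {j} → j < k → 0 < D j
  D-pos {j} j<k = n≢0⇒n>0 λ Dj≡0 → <-irrefl (distinct P j k (<⇒≤ j<k) ≤-refl
    (trans (zero-length⇒start≡end (subst (TPath G (vert P j) z) Dj≡0 (proj₁ (proj₁ (D-isDist (<⇒≤ j<k))))))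
           (sym (end P)))) j<k

  D-step : ∀ {j} → j < k → D j ≤ suc (D (suc j))
  D-step {j} j<k with D-isDist j<k
  ... | (Q , departsQ) , _ with anyUpTo? (λ a → vert Q a ≟ᶠ vert P j) (suc (D (suc j)))
  ...   | yes (a , a<1+m , Qa≡Pj) =
    ≤-trans (proj₂ (D-isDist (<⇒≤ j<k)) _ shortcut) (≤-trans (m∸n≤m _ a) (n≤1+n _))
    where
    shortcut : Reach G z (vert P j) (depart j) (D (suc j) ∸ a)
    shortcut = subst (λ v → Reach G z v (depart j) (D (suc j) ∸ a)) Qa≡Pj
      (suffix Q a (s≤s⁻¹ a<1+m) , λ 0<m∸a →
        let a<m = m∸n≢0⇒n<m {D (suc j)} {a} λ e → <-irrefl (sym e) 0<m∸a in
        begin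
          depart j        ≡⟨ depart-inner j<k ⟩
          time P (suc j)  ≤⟨ time≤depart j<k ⟩
          depart (suc j)  ≤⟨ departsQ (≤-<-trans z≤n a<m) ⟩
          time Q 1        ≤⟨ time-mono Q ≤-refl (m≤n+m 1 a) (subst (_≤ D (suc j)) (+-comm 1 a) a<m) ⟩
          time Q (a + 1)  ∎)
      where open ≤-Reasoning
  ...   | no fresh = proj₂ (D-isDist (<⇒≤ j<k)) _
    ( prepend Q (edges P j j<k) (λ a a≤m eq → fresh (a , s≤s a≤m , eq))
                (λ 1≤m → ≤-trans (time≤depart j<k) (departsQ 1≤m))
    , λ _ → ≤-reflexive (depart-inner j<k))

  D-start : ∀ {ds} → d s 1 ≡ fin ds → ds ≤ D 0
  D-start d-s≡ds with subst (λ v → Reach G z v (depart 0) (D 0)) (start P) (proj₁ (D-isDist z≤n))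
  ... | R , _ = proj₂ (subst (IsDist G z s 1) d-s≡ds (d-isDist s 1)) (D 0) (R , departs-after-1 R)

  open Profile k D D-step D-last D-pos

  D<⇒<∞ : ∀ {i j} → i ≤ k → j ≤ k → D i < D j
         → d (vert P i) (depart i) <∞ d (vert P j) (depart j)
  D<⇒<∞ i≤k j≤k Di<Dj rewrite D-finite i≤k | D-finite j≤k = Di<Dj

  separator⇒distSep : ∀ {p} → p ≤ k → Separator p → DistSep G d P p
  separator⇒distSep {p} p≤k (left , right) =
    (λ j j<p → D<⇒<∞ p≤k (≤-trans (<⇒≤ j<p) p≤k) (left j j<p)) ,
    (λ j p<j j≤k → D<⇒<∞ j≤k p≤k (right j p<j j≤k))

  distSep-within : ∀ {i} → i ≤ k → ∃ λ j → j ≤ 2 * (k ∸ D 0) × i + j ≤ k × DistSep G d P (i + j)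
  distSep-within {i} i≤k =
    let (p , i≤p , p≤k , sep , p∸i≤) = separator-within i≤k
    in p ∸ i , p∸i≤ ,
       subst (λ p′ → p′ ≤ k × DistSep G d P p′) (sym (m+[n∸m]≡n i≤p)) (p≤k , separator⇒distSep p≤k sep)

lemma4 : (G : TemporalGraph) (s z : Fin (n G)) → ¬ (s ≡ z) → (δ k : ℕ)
         → (d : Fin (n G) → ℕ → ℕ∞) → (∀ v t → IsDist G z v t (d v t))
         → (ds : ℕ) → d s 1 ≡ fin ds → ds ≤ k
         → (P : TPath G s z k) → Restless δ P
         → ∀ i → i ≤ k
         → Σ ℕ λ j → (j ≤ 2 * (k ∸ ds)) × (i + j ≤ k) × DistSep G d P (i + j)
lemma4 G s z _ δ k d d-isDist ds d-s≡ds _ P _ i i≤k =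
  let open PathProfile d d-isDist P
      (j , j≤ , i+j≤k , sep) = distSep-within i≤k
  in j , ≤-trans j≤ (*-monoʳ-≤ 2 (∸-monoʳ-≤ k (D-start d-s≡ds))) , i+j≤k , sep
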